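{- Let $p$ be an odd prime, let $1\le i,j\le p$ and $e,e'\in\mathbb{F}_p$. Call a surjective group homomorphism $\varphi\colon B_{i,e}\to B_{j,e'}$ a $G$-surjection if its kernel is contained in the normal subgroup $A/A_i$ of $B_{i,e}$, $\varphi$ is compatible with the projections of $B_{i,e}$ and $B_{j,e'}$ onto $G$, and $\varphi$ restricts to an $\mathbb{F}_p[G]$-module homomorphism $A/A_i\to A/A_j$. Then a $G$-surjection $B_{i,e}\to B_{j,e'}$ exists only if $i>j$ and $e'=0$, and in that case its kernel is $A_j/A_i$. Conversely, for every $i>j\ge1$ and every $e\in\mathbb{F}_p$, the quotient map $B_{i,e}\to B_{i,e}/(A_j/A_i)\cong B_{j,0}$ is a $G$-surjection.
   Context: $G=\langle\sigma\rangle$ is cyclic of order $p$. $A=\bigoplus_{k=0}^{p-1}\mathbb{F}_p\tau^k$ is the free $\mathbb{F}_p[G]$-module on $\tau$, $\sigma$ acting by multiplication by $\tau$. For $1\le i<p$, $A_i$ is the $\mathbb{F}_p$-span of $(\tau-1)^i,\dots,(\tau-1)^{p-1}$, and $A_p=0$; $A/A_i$ has $\mathbb{F}_p$-basis the images $1,\overline{\tau-1},\dots,(\overline{\tau-1})^{i-1}$. For $e\in\mathbb{F}_p$, $B_{i,e}$ denotes the group extension $1\to A/A_i\to B_{i,e}\to G\to1$ in which conjugation by a lift $\tilde\sigma$ of $\sigma$ acts on $A/A_i$ as multiplication by $\tau$ and $\tilde\sigma^p=e(\overline{\tau-1})^{i-1}$ (written additively in $A/A_i$). Thus $B_{i,0}=(A/A_i)\rtimes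 G$. -}

module Defs where

open import Data.Nat using (ℕ; zero; suc; _+_; _*_; _≤_; _<_; _≤ᵇ_; _≡ᵇ_; NonZero)
open import Data.Nat.DivMod using (_mod_)
open import Data.Fin using (Fin; toℕ; inject₁; inject≤)
open import Data.Vec using (Vec; []; _∷_; lookup; tabulate; replicate; zipWith; map)
open import Data.Product using (Σ; _×_; _,_; proj₁; proj₂)
open import Data.Bool using (if_then_else_)
open import Relation.Binary.PropositionalEquality using (_≡_; _≢_)
open import Function.Bundles using (_⇔_)

𝔽 : (p : ℕ) → Set
𝔽 p = Fin p

module _ (p : ℕ) .{{_ : NonZero p}} where

  0F : 𝔽 p
  0F = 0 mod p

  _+F_ : 𝔽 p → 𝔽 p → 𝔽 p
  a +F b = (toℕ a + toℕ b) mod p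

  _*F_ : 𝔽 p → 𝔽 p → 𝔽 p
  a *F b = (toℕ a * toℕ b) mod p

  -- A/A_i : vector of coordinates w.r.t. the basis 1, (τ-1), ..., (τ-1)^(i-1);
  -- coordinate m is the coefficient of (τ-1)^m.
  Quot : ℕ → Set
  Quot i = Vec (𝔽 p) i

  zeroQ : ∀ {i} → Quot i
  zeroQ = replicate _ 0F

  addQ : ∀ {i} → Quot i → Quot i → Quot i
  addQ = zipWith _+F_

  scaleQ : ∀ {i} → 𝔽 p → Quot i → Quot i
  scaleQ c = map (c *F_)

  -- multiplication by x = τ - 1 (x^i = 0 in A/A_i)
  mulX : ∀ {i} → Quot i → Quot i
  mulX {zero}  v = []
  mulX {suc n} v = 0F ∷ tabulate (λ m → lookup v (inject₁ m))

  mulτ : ∀ {i} → Quot i → Quot i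
  mulτ v = addQ v (mulX v)

  mulτ^ : ∀ {i} → ℕ → Quot i → Quot i
  mulτ^ zero    v = v
  mulτ^ (suc k) v = mulτ (mulτ^ k v)

  top : ∀ {i} → 𝔽 p → Quot i
  top {zero}  e = []
  top {suc n} e = tabulate (λ m → if toℕ m ≡ᵇ n then e else 0F)

  -- The group B_{i,e}: element (a , k) stands for a · σ̃^k with a ∈ A/A_i, k ∈ Z/p.
  B : (i : ℕ) (e : 𝔽 p) → Set
  B i e = Quot i × 𝔽 p

  -- a σ̃^k · b σ̃^l = (a + τ^k b) σ̃^(k+l), and σ̃^p = e (τ-1)^(i-1).
  mulB : ∀ i (e : 𝔽 p) → B i e → B i e → B i e
  mulB i e (a , k) (b , l) =
    ( addQ (addQ a (mulτ^ (toℕ k) b))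
           (if p ≤ᵇ (toℕ k + toℕ l) then top e else zeroQ)
    , k +F l )

  oneB : ∀ i (e : 𝔽 p) → B i e
  oneB i e = (zeroQ , 0F)

  IsHom : ∀ i j (e e' : 𝔽 p) → (B i e → B j e') → Set
  IsHom i j e e' φ = ∀ g h → φ (mulB i e g h) ≡ mulB j e' (φ g) (φ h)

  record IsGSurjection (i j : ℕ) (e e' : 𝔽 p) (φ : B i e → B j e') : Set where
    field
      hom        : IsHom i j e e' φ
      surjective : ∀ y → Σ (B i e) (λ x → φ x ≡ y)
      kerInA     : ∀ g → φ g ≡ oneB j e' → proj₂ g ≡ 0F
      overG      : ∀ g → proj₂ (φ g) ≡ proj₂ g
      -- restriction to A/A_i lands in A/A_j and is an F_p[G]-module homomorphism
      restrictA  : ∀ a → proj₂ (φ (a , 0F)) ≡ 0F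
      restrAdd   : ∀ a b → proj₁ (φ (addQ a b , 0F)) ≡ addQ (proj₁ (φ (a , 0F))) (proj₁ (φ (b , 0F)))
      restrScale : ∀ c a → proj₁ (φ (scaleQ c a , 0F)) ≡ scaleQ c (proj₁ (φ (a , 0F)))
      restrτ     : ∀ a → proj₁ (φ (mulτ a , 0F)) ≡ mulτ (proj₁ (φ (a , 0F)))

  NontrivialKernel : ∀ i j (e e' : 𝔽 p) → (B i e → B j e') → Set
  NontrivialKernel i j e e' φ = Σ (B i e) (λ g → φ g ≡ oneB j e' × g ≢ oneB i e)

  InAjAi : ∀ i j (e : 𝔽 p) → B i e → Set
  InAjAi i j e (a , k) = (k ≡ 0F) × (∀ (m : Fin i) → toℕ m < j → lookup a m ≡ 0F)

  KernelIsAjAi : ∀ i j (e e' : 𝔽 p) → (B i e → B j e') → Set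
  KernelIsAjAi i j e e' φ = ∀ g → (φ g ≡ oneB j e') ⇔ InAjAi i j e g

  quotMap : ∀ i j (e : 𝔽 p) → j ≤ i → B i e → B j 0F
  quotMap i j e j≤i (a , k) = (tabulate (λ m → lookup a (inject≤ m j≤i)) , k)

-- Write A/A_i as 𝔽ₚ[X]/(X^i) with X = τ - 1.  A G-surjection φ restricts to an additive map
-- φᴬ : A/A_i → A/A_j commuting with τ, hence with X.  If a has lowest nonzero coefficient a_m at X^m
-- with m < j, then φᴬ(a) has coefficient a_m·u₀ at X^m, where u₀ is the constant term of φᴬ(1), and
-- u₀ ≠ 0 by surjectivity.  So ker φᴬ = X^j·(A/A_i) = A_j/A_i, and a nontrivial kernel forces j < i.
-- Then σ̃^p = e·X^(i-1) lies in the kernel, whereas, writing φ(σ̃) = c·σ̃,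
-- φ(σ̃)^p = (1 + τ + ⋯ + τ^(p-1))·c + e'·X^(j-1) = e'·X^(j-1): indeed 1 + τ + ⋯ + τ^(p-1) is
-- Σ_k C(p,k+1)·X^k, which vanishes on A/A_j for j < p.  Hence e' = 0.  Conversely, truncation
-- A/A_i → A/A_j commutes with τ and kills e·X^(i-1), so it is a G-surjection B_{i,e} → B_{j,0}.
module Submission where

open import Defs
open import Algebra.Properties.CommutativeSemigroup using (interchange)
open import Data.Bool using (true; false; if_then_else_)
open import Data.Bool.Properties using (T-≡; ¬-not; if-eta)
open import Data.Empty using (⊥-elim)
open import Data.Fin using (Fin; toℕ; fromℕ<; inject₁; inject≤) renaming (zero to fzero; suc to fsuc)
open import Data.Fin.Properties using (toℕ-injective; toℕ<n; toℕ-fromℕ<; toℕ-inject₁; toℕ-inject≤)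
open import Data.Nat
  using (ℕ; zero; suc; _+_; _*_; _∸_; _≤_; _<_; _≤ᵇ_; _≡ᵇ_; _%_; _!; z≤n; s≤s; z<s; s<s;
         NonZero; >-nonZero⁻¹; nonTrivial⇒n>1)
open import Data.Nat.Properties
open import Data.Nat.Combinatorics using (_C_; nCk≡n!/k![n-k]!; k![n∸k]!∣n!; nCk+nC[k+1]≡[n+1]C[k+1])
open import Data.Nat.DivMod using (_mod_; m/n*n≡m; m<n⇒m%n≡m; %-distribˡ-+; [m+n]%n≡m%n; n%n≡0)
open import Data.Nat.Divisibility
  using (_∣_; ∣-refl; ∣1⇒≡1; ∣⇒≤; ∣m⇒∣m*n; ∣m∣n⇒∣m+n; n∣m⇒m%n≡0; m%n≡0⇒n∣m)
open import Data.Nat.Induction using (<-rec)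
open import Data.Nat.Primality using (Prime; euclidsLemma; ¬prime[1]; prime⇒nonTrivial)
open import Data.Product using (_×_; _,_; proj₁; map₂)
open import Data.Product.Properties using (,-injectiveˡ; ,-injectiveʳ)
open import Data.Sum using (_⊎_; inj₁; inj₂)
open import Data.Vec using (Vec; []; _∷_; lookup; tabulate; replicate; zipWith; map)
open import Data.Vec.Properties using (tabulate-cong)
open import Function.Base using (_∘_)
open import Function.Bundles using (_⇔_; mk⇔; Equivalence)
open import Function.Properties.Equivalence using () renaming (trans to ⇔-trans; sym to ⇔-sym)
open import Relation.Nullary using (¬_; yes; no)
open import Relation.Binary.PropositionalEquality

-- Binomial coefficients modulo a prime

nCk*k![n∸k]!≡n! : ∀ {n k} → k ≤ n → (n C k) * (k ! * (n ∸ k) !) ≡ n !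
nCk*k![n∸k]!≡n! {n} {k} k≤n =
  trans (cong (_* (k ! * (n ∸ k) !)) (nCk≡n!/k![n-k]! k≤n))
        (m/n*n≡m {{k !* (n ∸ k) !≢0}} (k![n∸k]!∣n! k≤n))

n∣n! : ∀ {n} → 0 < n → n ∣ n !
n∣n! {suc n} _ = ∣m⇒∣m*n (n !) ∣-refl

module _ {p : ℕ} (p-prime : Prime p) where

  prime∤m! : ∀ {m} → m < p → ¬ p ∣ m !
  prime∤m! {zero}  _   p∣1  = ¬prime[1] (subst Prime (∣1⇒≡1 p∣1) p-prime)
  prime∤m! {suc m} m<p p∣m! with euclidsLemma (suc m) (m !) p-prime p∣m!
  ... | inj₁ p∣1+m = <⇒≱ m<p (∣⇒≤ p∣1+m)
  ... | inj₂ p∣m!′ = prime∤m! (<-trans (n<1+n m) m<p) p∣m!′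

  prime∣pCk : ∀ {k} → 0 < k → k < p → p ∣ p C k
  prime∣pCk {k} 0<k k<p
    with euclidsLemma (p C k) (k ! * (p ∸ k) !) p-prime
           (subst (p ∣_) (sym (nCk*k![n∸k]!≡n! (<⇒≤ k<p))) (n∣n! (<-trans 0<k k<p)))
  ... | inj₁ p∣pCk = p∣pCk
  ... | inj₂ p∣k![p∸k]! with euclidsLemma (k !) ((p ∸ k) !) p-prime p∣k![p∸k]!
  ...   | inj₁ p∣k!     = ⊥-elim (prime∤m! k<p p∣k!)
  ...   | inj₂ p∣[p∸k]! = ⊥-elim (prime∤m! (∸-monoʳ-< 0<k (<⇒≤ k<p)) p∣[p∸k]!)

≡ᵇ-refl : ∀ n → (n ≡ᵇ n) ≡ true
≡ᵇ-refl n = Equivalence.to T-≡ (≡⇒≡ᵇ n n refl)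

≢⇒≡ᵇ-false : ∀ {m n} → m ≢ n → (m ≡ᵇ n) ≡ false
≢⇒≡ᵇ-false {m} {n} m≢n = ¬-not (m≢n ∘ ≡ᵇ⇒≡ m n ∘ Equivalence.from T-≡)

≤⇒≤ᵇ-true : ∀ {m n} → m ≤ n → (m ≤ᵇ n) ≡ true
≤⇒≤ᵇ-true = Equivalence.to T-≡ ∘ ≤⇒≤ᵇ

>⇒≤ᵇ-false : ∀ {m n} → n < m → (m ≤ᵇ n) ≡ false
>⇒≤ᵇ-false {m} {n} n<m = ¬-not (<⇒≱ n<m ∘ ≤ᵇ⇒≤ m n ∘ Equivalence.from T-≡)

convolve : (ℕ → ℕ) → (ℕ → ℕ) → ℕ → ℕ
convolve c v zero    = c 0 * v 0
convolve c v (suc m) = c 0 * v (suc m) + convolve (c ∘ suc) v m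

module _ (v : ℕ → ℕ) where

  convolve-congˡ : ∀ {c d} m → (∀ k → c k ≡ d k) → convolve c v m ≡ convolve d v m
  convolve-congˡ zero    c≗d = cong (_* v 0) (c≗d 0)
  convolve-congˡ (suc m) c≗d = cong₂ _+_ (cong (_* v (suc m)) (c≗d 0)) (convolve-congˡ m (c≗d ∘ suc))

  convolve-+ˡ : ∀ c d m → convolve (λ k → c k + d k) v m ≡ convolve c v m + convolve d v m
  convolve-+ˡ c d zero    = *-distribʳ-+ (v 0) (c 0) (d 0)
  convolve-+ˡ c d (suc m) = begin
    (c 0 + d 0) * v (suc m) + convolve (λ k → c (suc k) + d (suc k)) v m
      ≡⟨ cong₂ _+_ (*-distribʳ-+ (v (suc m)) (c 0) (d 0)) (convolve-+ˡ (c ∘ suc) (d ∘ suc) m) ⟩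
    (c 0 * v (suc m) + d 0 * v (suc m)) + (convolve (c ∘ suc) v m + convolve (d ∘ suc) v m)
      ≡⟨ interchange +-commutativeSemigroup (c 0 * v (suc m)) _ _ _ ⟩
    (c 0 * v (suc m) + convolve (c ∘ suc) v m) + (d 0 * v (suc m) + convolve (d ∘ suc) v m) ∎
    where open ≡-Reasoning

  convolve-zeroˡ : ∀ m → convolve (λ _ → 0) v m ≡ 0
  convolve-zeroˡ zero    = refl
  convolve-zeroˡ (suc m) = convolve-zeroˡ m

  convolve-identityˡ : ∀ m → convolve (0 C_) v m ≡ v m
  convolve-identityˡ zero    = +-identityʳ (v 0)
  convolve-identityˡ (suc m) =
    trans (cong₂ _+_ (+-identityʳ (v (suc m))) (convolve-zeroˡ m)) (+-identityʳ (v (suc m)))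

  convolve-pascal : ∀ n m →
    convolve (λ k → suc n C suc k) v m ≡ convolve (λ k → n C suc k) v m + convolve (n C_) v m
  convolve-pascal n m =
    trans (convolve-congˡ m (λ k → trans (sym (nCk+nC[k+1]≡[n+1]C[k+1] n k)) (+-comm (n C k) _)))
          (convolve-+ˡ (λ k → n C suc k) (n C_) m)

  convolve-pascal-suc : ∀ n m → convolve (suc n C_) v (suc m) ≡ convolve (n C_) v (suc m) + convolve (n C_) v m
  convolve-pascal-suc n m =
    trans (cong (1 * v (suc m) +_) (convolve-pascal n m)) (sym (+-assoc (1 * v (suc m)) _ _))

  convolve-∣ˡ : ∀ {d c} m → (∀ k → k ≤ m → d ∣ c k) → d ∣ convolve c v m
  convolve-∣ˡ zero    d∣c = ∣m⇒∣m*n (v 0) (d∣c 0 z≤n)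
  convolve-∣ˡ (suc m) d∣c =
    ∣m∣n⇒∣m+n (∣m⇒∣m*n (v (suc m)) (d∣c 0 z≤n))
              (convolve-∣ˡ m (λ k k≤m → d∣c (suc k) (s≤s k≤m)))

module Coefficients {A : Set} (default : A) where

  coeff : ∀ {n} → Vec A n → ℕ → A
  coeff []      m       = default
  coeff (x ∷ v) zero    = x
  coeff (x ∷ v) (suc m) = coeff v m

  coeff-lookup : ∀ {n} (v : Vec A n) (k : Fin n) → lookup v k ≡ coeff v (toℕ k)
  coeff-lookup (x ∷ v) fzero    = refl
  coeff-lookup (x ∷ v) (fsuc k) = coeff-lookup v k

  coeff-≥ : ∀ {n} (v : Vec A n) {m} → n ≤ m → coeff v m ≡ default
  coeff-≥ []      _         = refl
  coeff-≥ (x ∷ v) (s≤s n≤m) = coeff-≥ v n≤m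

  coeff-ext : ∀ {n} {v w : Vec A n} → (∀ m → m < n → coeff v m ≡ coeff w m) → v ≡ w
  coeff-ext {v = []}    {[]}    _   = refl
  coeff-ext {v = x ∷ v} {y ∷ w} v≈w = cong₂ _∷_ (v≈w 0 z<s) (coeff-ext (λ m m<n → v≈w (suc m) (s<s m<n)))

  coeff-tabulate : ∀ {n} (f : ℕ → A) {m} → m < n → coeff (tabulate {n = n} (f ∘ toℕ)) m ≡ f m
  coeff-tabulate {suc n} f {zero}  _         = refl
  coeff-tabulate {suc n} f {suc m} (s<s m<n) = coeff-tabulate (f ∘ suc) m<n

  coeff-replicate : ∀ n m → coeff (replicate n default) m ≡ default
  coeff-replicate zero    m       = refl
  coeff-replicate (suc n) zero    = refl
  coeff-replicate (suc n) (suc m) = coeff-replicate n m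

  coeff-zipWith : ∀ {n} (f : A → A → A) (v w : Vec A n) {m} → m < n →
                  coeff (zipWith f v w) m ≡ f (coeff v m) (coeff w m)
  coeff-zipWith f (x ∷ v) (y ∷ w) {zero}  _         = refl
  coeff-zipWith f (x ∷ v) (y ∷ w) {suc m} (s<s m<n) = coeff-zipWith f v w m<n

  coeff-map : ∀ {n} (f : A → A) (v : Vec A n) {m} → m < n → coeff (map f v) m ≡ f (coeff v m)
  coeff-map f (x ∷ v) {zero}  _         = refl
  coeff-map f (x ∷ v) {suc m} (s<s m<n) = coeff-map f v m<n

module _ (p : ℕ) .{{_ : NonZero p}} where

  -- The field 𝔽ₚ

  infixl 6 _+ₚ_
  infixl 7 _*ₚ_

  0ₚ : 𝔽 p
  0ₚ = 0F p

  _+ₚ_ : 𝔽 p → 𝔽 p → 𝔽 p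
  _+ₚ_ = _+F_ p

  _*ₚ_ : 𝔽 p → 𝔽 p → 𝔽 p
  _*ₚ_ = _*F_ p

  toℕ-mod : ∀ n → toℕ (n mod p) ≡ n % p
  toℕ-mod n = toℕ-fromℕ< _

  toℕ-mod-< : ∀ {n} → n < p → toℕ (n mod p) ≡ n
  toℕ-mod-< n<p = trans (toℕ-mod _) (m<n⇒m%n≡m n<p)

  toℕ-0ₚ : toℕ 0ₚ ≡ 0
  toℕ-0ₚ = toℕ-mod-< (>-nonZero⁻¹ p)

  toℕ%p : (a : 𝔽 p) → toℕ a % p ≡ toℕ a
  toℕ%p a = m<n⇒m%n≡m (toℕ<n a)

  ∣⇒≡0ₚ : ∀ {a : 𝔽 p} {n} → toℕ a ≡ n % p → p ∣ n → a ≡ 0ₚ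
  ∣⇒≡0ₚ {a} {n} a≡n p∣n = toℕ-injective (trans a≡n (trans (n∣m⇒m%n≡0 n p p∣n) (sym toℕ-0ₚ)))

  toℕ-+ₚ : ∀ {a b : 𝔽 p} {m n} → toℕ a ≡ m % p → toℕ b ≡ n % p → toℕ (a +ₚ b) ≡ (m + n) % p
  toℕ-+ₚ {a} {b} {m} {n} a≡m b≡n =
    trans (toℕ-mod _) (trans (cong₂ (λ x y → (x + y) % p) a≡m b≡n) (sym (%-distribˡ-+ m n p)))

  +ₚ-identityʳ : (a : 𝔽 p) → a +ₚ 0ₚ ≡ a
  +ₚ-identityʳ a = toℕ-injective
    (trans (toℕ-+ₚ (sym (toℕ%p a)) (toℕ-mod 0)) (trans (cong (_% p) (+-identityʳ (toℕ a))) (toℕ%p a)))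

  +ₚ-identityˡ : (a : 𝔽 p) → 0ₚ +ₚ a ≡ a
  +ₚ-identityˡ a = toℕ-injective (trans (toℕ-+ₚ {n = toℕ a} (toℕ-mod 0) (sym (toℕ%p a))) (toℕ%p a))

  *ₚ-zeroʳ : (a : 𝔽 p) → a *ₚ 0ₚ ≡ 0ₚ
  *ₚ-zeroʳ a = toℕ-injective (begin
    toℕ (a *ₚ 0ₚ)        ≡⟨ toℕ-mod _ ⟩
    (toℕ a * toℕ 0ₚ) % p ≡⟨ cong (λ z → (toℕ a * z) % p) toℕ-0ₚ ⟩
    (toℕ a * 0) % p      ≡⟨ cong (_% p) (*-zeroʳ (toℕ a)) ⟩
    0 % p                ≡⟨ sym (toℕ-mod 0) ⟩
    toℕ 0ₚ               ∎)
    where open ≡-Reasoning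

  +ₚ-cancelˡ : (a b c : 𝔽 p) → a +ₚ b ≡ a +ₚ c → b ≡ c
  +ₚ-cancelˡ a b c a+b≡a+c = toℕ-injective (begin
    toℕ b                                       ≡⟨ sym (toℕ%p b) ⟩
    toℕ b % p                                   ≡⟨ sym (negate-cancel (toℕ b)) ⟩
    (p ∸ toℕ a + (toℕ a + toℕ b)) % p           ≡⟨ %-distribˡ-+ (p ∸ toℕ a) _ p ⟩
    ((p ∸ toℕ a) % p + (toℕ a + toℕ b) % p) % p ≡⟨ cong (λ z → ((p ∸ toℕ a) % p + z) % p) a+b≡a+c′ ⟩
    ((p ∸ toℕ a) % p + (toℕ a + toℕ c) % p) % p ≡⟨ sym (%-distribˡ-+ (p ∸ toℕ a) _ p) ⟩
    (p ∸ toℕ a + (toℕ a + toℕ c)) % p           ≡⟨ negate-cancel (toℕ c) ⟩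
    toℕ c % p                                   ≡⟨ toℕ%p c ⟩
    toℕ c                                       ∎)
    where
      open ≡-Reasoning
      a+b≡a+c′ : (toℕ a + toℕ b) % p ≡ (toℕ a + toℕ c) % p
      a+b≡a+c′ = trans (sym (toℕ-mod _)) (trans (cong toℕ a+b≡a+c) (toℕ-mod _))
      negate-cancel : ∀ n → (p ∸ toℕ a + (toℕ a + n)) % p ≡ n % p
      negate-cancel n = begin
        (p ∸ toℕ a + (toℕ a + n)) % p ≡⟨ cong (_% p) (sym (+-assoc (p ∸ toℕ a) (toℕ a) n)) ⟩
        (p ∸ toℕ a + toℕ a + n) % p   ≡⟨ cong (λ z → (z + n) % p) (m∸n+n≡m (<⇒≤ (toℕ<n a))) ⟩
        (p + n) % p                   ≡⟨ cong (_% p) (+-comm p n) ⟩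
        (n + p) % p                   ≡⟨ [m+n]%n≡m%n n p ⟩
        n % p                         ∎

  -- A/A_n as 𝔽ₚ[X]/(X^n)

  open Coefficients 0ₚ public

  coeff-zeroQ : ∀ {n} m → coeff (zeroQ p {n}) m ≡ 0ₚ
  coeff-zeroQ {n} = coeff-replicate n

  coeff-addQ : ∀ {n} (v w : Quot p n) {m} → m < n → coeff (addQ p v w) m ≡ coeff v m +ₚ coeff w m
  coeff-addQ = coeff-zipWith _+ₚ_

  coeff-scaleQ : ∀ {n} c (v : Quot p n) {m} → m < n → coeff (scaleQ p c v) m ≡ c *ₚ coeff v m
  coeff-scaleQ c = coeff-map (c *ₚ_)

  coeff-mulX-zero : ∀ {n} (v : Quot p n) → coeff (mulX p v) 0 ≡ 0ₚ
  coeff-mulX-zero {zero}  v = refl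
  coeff-mulX-zero {suc n} v = refl

  coeff-mulX-suc : ∀ {n} (v : Quot p n) {m} → suc m < n → coeff (mulX p v) (suc m) ≡ coeff v m
  coeff-mulX-suc {suc n} v {m} (s<s m<n) = begin
    coeff (tabulate (λ k → lookup v (inject₁ k))) m ≡⟨ cong (λ w → coeff w m) (tabulate-cong lookup≗coeff) ⟩
    coeff (tabulate {n = n} (coeff v ∘ toℕ)) m     ≡⟨ coeff-tabulate (coeff v) m<n ⟩
    coeff v m                                      ∎
    where
      open ≡-Reasoning
      lookup≗coeff : ∀ k → lookup v (inject₁ k) ≡ coeff v (toℕ k)
      lookup≗coeff k = trans (coeff-lookup v (inject₁ k)) (cong (coeff v) (toℕ-inject₁ k))

  coeff-top : ∀ {n} e {m} → m < suc n → coeff (top p {suc n} e) m ≡ (if m ≡ᵇ n then e else 0ₚ)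
  coeff-top {n} e = coeff-tabulate (λ m → if m ≡ᵇ n then e else 0ₚ)

  coeff-top-last : ∀ {n} e → coeff (top p {suc n} e) n ≡ e
  coeff-top-last {n} e = trans (coeff-top e (n<1+n n)) (cong (if_then e else 0ₚ) (≡ᵇ-refl n))

  top-0ₚ : ∀ {n} → top p {n} 0ₚ ≡ zeroQ p
  top-0ₚ {zero}  = refl
  top-0ₚ {suc n} = coeff-ext λ m m<n →
    trans (coeff-top 0ₚ m<n) (trans (if-eta (m ≡ᵇ n)) (sym (coeff-zeroQ {suc n} m)))

  addQ-identityˡ : ∀ {n} (v : Quot p n) → addQ p (zeroQ p) v ≡ v
  addQ-identityˡ {n} v = coeff-ext λ m m<n →
    trans (coeff-addQ (zeroQ p) v m<n) (trans (cong (_+ₚ coeff v m) (coeff-zeroQ {n} m)) (+ₚ-identityˡ _))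

  addQ-identityʳ : ∀ {n} (v : Quot p n) → addQ p v (zeroQ p) ≡ v
  addQ-identityʳ {n} v = coeff-ext λ m m<n →
    trans (coeff-addQ v (zeroQ p) m<n) (trans (cong (coeff v m +ₚ_) (coeff-zeroQ {n} m)) (+ₚ-identityʳ _))

  addQ-cancelˡ : ∀ {n} (u v w : Quot p n) → addQ p u v ≡ addQ p u w → v ≡ w
  addQ-cancelˡ u v w u+v≡u+w = coeff-ext λ m m<n → +ₚ-cancelˡ (coeff u m) _ _
    (trans (sym (coeff-addQ u v m<n)) (trans (cong (λ z → coeff z m) u+v≡u+w) (coeff-addQ u w m<n)))

  mulX-zeroQ : ∀ {n} → mulX p (zeroQ p {n}) ≡ zeroQ p
  mulX-zeroQ {n} = coeff-ext coeff≡
    where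
      coeff≡ : ∀ m → m < n → coeff (mulX p (zeroQ p {n})) m ≡ coeff (zeroQ p {n}) m
      coeff≡ zero    _   = trans (coeff-mulX-zero (zeroQ p {n})) (sym (coeff-zeroQ {n} 0))
      coeff≡ (suc m) m<n =
        trans (coeff-mulX-suc (zeroQ p) m<n) (trans (coeff-zeroQ {n} m) (sym (coeff-zeroQ {n} (suc m))))

  mulτ^-zeroQ : ∀ {n} k → mulτ^ p k (zeroQ p {n}) ≡ zeroQ p
  mulτ^-zeroQ zero        = refl
  mulτ^-zeroQ {n} (suc k) rewrite mulτ^-zeroQ {n} k | mulX-zeroQ {n} = addQ-identityˡ (zeroQ p)

  VanishesBelow : ∀ {n} → ℕ → Quot p n → Set
  VanishesBelow k a = ∀ m → m < k → coeff a m ≡ 0ₚ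

  vanishesBelow-mono : ∀ {n k l} (a : Quot p n) → k ≤ l → VanishesBelow l a → VanishesBelow k a
  vanishesBelow-mono _ k≤l a≈0 m m<k = a≈0 m (<-≤-trans m<k k≤l)

  vanishesBelow⇒≡zeroQ : ∀ {n} {a : Quot p n} → VanishesBelow n a → a ≡ zeroQ p
  vanishesBelow⇒≡zeroQ {n} a≈0 = coeff-ext λ m m<n → trans (a≈0 m m<n) (sym (coeff-zeroQ {n} m))

  top-vanishesBelow : ∀ {n k} e → k < n → VanishesBelow k (top p {n} e)
  top-vanishesBelow {suc n} e (s≤s k≤n) m m<k =
    trans (coeff-top e (<-≤-trans m<k (m≤n⇒m≤1+n k≤n)))
          (cong (if_then e else 0ₚ) (≢⇒≡ᵇ-false (<⇒≢ (<-≤-trans m<k k≤n))))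

  mulX^ : ∀ {n} → ℕ → Quot p n → Quot p n
  mulX^ zero    v = v
  mulX^ (suc k) v = mulX p (mulX^ k v)

  divX^ : ∀ {n} → ℕ → Quot p n → Quot p n
  divX^ k a = tabulate (λ t → coeff a (toℕ t + k))

  coeff-divX^ : ∀ {n} k (a : Quot p n) {m} → m < n → coeff (divX^ k a) m ≡ coeff a (m + k)
  coeff-divX^ k a = coeff-tabulate (λ m → coeff a (m + k))

  coeff-mulX^-≥ : ∀ {n} k (v : Quot p n) {m} → k ≤ m → m < n → coeff (mulX^ k v) m ≡ coeff v (m ∸ k)
  coeff-mulX^-≥ zero    v         _         _   = refl
  coeff-mulX^-≥ (suc k) v {suc m} (s≤s k≤m) m<n =
    trans (coeff-mulX-suc (mulX^ k v) m<n) (coeff-mulX^-≥ k v k≤m (<-trans (n<1+n m) m<n))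

  mulX^-vanishesBelow : ∀ {n} k (v : Quot p n) → VanishesBelow k (mulX^ k v)
  mulX^-vanishesBelow (suc k) v zero    _ = coeff-mulX-zero (mulX^ k v)
  mulX^-vanishesBelow {n} (suc k) v (suc m) (s<s m<k) with suc m <? n
  ... | yes 1+m<n = trans (coeff-mulX-suc (mulX^ k v) 1+m<n) (mulX^-vanishesBelow k v m m<k)
  ... | no  1+m≮n = coeff-≥ (mulX^ (suc k) v) (≮⇒≥ 1+m≮n)

  mulX^-nilpotent : ∀ {n} k (v : Quot p n) → n ≤ k → mulX^ k v ≡ zeroQ p
  mulX^-nilpotent k v n≤k = vanishesBelow⇒≡zeroQ (vanishesBelow-mono (mulX^ k v) n≤k (mulX^-vanishesBelow k v))

  mulX^-divX^ : ∀ {n} k (a : Quot p n) → VanishesBelow k a → mulX^ k (divX^ k a) ≡ a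
  mulX^-divX^ k a a≈0 = coeff-ext coeff≡
    where
      coeff≡ : ∀ m → m < _ → coeff (mulX^ k (divX^ k a)) m ≡ coeff a m
      coeff≡ m m<n with m <? k
      ... | yes m<k = trans (mulX^-vanishesBelow k (divX^ k a) m m<k) (sym (a≈0 m m<k))
      ... | no  m≮k = begin
        coeff (mulX^ k (divX^ k a)) m ≡⟨ coeff-mulX^-≥ k (divX^ k a) k≤m m<n ⟩
        coeff (divX^ k a) (m ∸ k)     ≡⟨ coeff-divX^ k a (≤-<-trans (m∸n≤m m k) m<n) ⟩
        coeff a (m ∸ k + k)           ≡⟨ cong (coeff a) (m∸n+n≡m k≤m) ⟩
        coeff a m                     ∎
        where
          open ≡-Reasoning
          k≤m = ≮⇒≥ m≮k

  lookup-vanishing⇔vanishesBelow : ∀ {i j} (a : Quot p i) →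
    (∀ (m : Fin i) → toℕ m < j → lookup a m ≡ 0ₚ) ⇔ VanishesBelow j a
  lookup-vanishing⇔vanishesBelow {i} {j} a = mk⇔ to from
    where
      to : (∀ (m : Fin i) → toℕ m < j → lookup a m ≡ 0ₚ) → VanishesBelow j a
      to a≈0 m m<j with m <? i
      ... | yes m<i = begin
        coeff a m                   ≡⟨ cong (coeff a) (sym (toℕ-fromℕ< m<i)) ⟩
        coeff a (toℕ (fromℕ< m<i)) ≡⟨ sym (coeff-lookup a (fromℕ< m<i)) ⟩
        lookup a (fromℕ< m<i)       ≡⟨ a≈0 (fromℕ< m<i) (subst (_< j) (sym (toℕ-fromℕ< m<i)) m<j) ⟩
        0ₚ                          ∎
        where open ≡-Reasoning
      ... | no  m≮i = coeff-≥ a (≮⇒≥ m≮i)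
      from : VanishesBelow j a → ∀ (m : Fin i) → toℕ m < j → lookup a m ≡ 0ₚ
      from a≈0 m m<j = trans (coeff-lookup a m) (a≈0 (toℕ m) m<j)

  InAjAi⇔ : ∀ {i j e} (a : Quot p i) (k : 𝔽 p) → InAjAi p i j e (a , k) ⇔ (k ≡ 0ₚ × VanishesBelow j a)
  InAjAi⇔ a k = mk⇔ (map₂ (Equivalence.to (lookup-vanishing⇔vanishesBelow a)))
                    (map₂ (Equivalence.from (lookup-vanishing⇔vanishesBelow a)))

  coords : ∀ {n} → Quot p n → ℕ → ℕ
  coords v = toℕ ∘ coeff v

  toℕ-coeff-mulτ^ : ∀ {d} (v : Quot p d) n {m} → m < d →
                    toℕ (coeff (mulτ^ p n v) m) ≡ convolve (n C_) (coords v) m % p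
  toℕ-coeff-mulτ^ v zero {m} m<d =
    trans (sym (toℕ%p _)) (cong (_% p) (sym (convolve-identityˡ (coords v) m)))
  toℕ-coeff-mulτ^ v (suc n) {zero} 0<d =
    trans (cong toℕ (coeff-addQ w (mulX p w) 0<d))
          (trans (toℕ-+ₚ (toℕ-coeff-mulτ^ v n 0<d) (trans (cong toℕ (coeff-mulX-zero w)) (toℕ-mod 0)))
                 (cong (_% p) (+-identityʳ _)))
    where w = mulτ^ p n v
  toℕ-coeff-mulτ^ v (suc n) {suc m} 1+m<d =
    trans (cong toℕ (coeff-addQ w (mulX p w) 1+m<d))
          (trans (toℕ-+ₚ (toℕ-coeff-mulτ^ v n 1+m<d)
                         (trans (cong toℕ (coeff-mulX-suc w 1+m<d)) (toℕ-coeff-mulτ^ v n (<-trans (n<1+n m) 1+m<d))))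
                 (cong (_% p) (sym (convolve-pascal-suc (coords v) n m))))
    where w = mulτ^ p n v

  norm : ∀ {d} → ℕ → Quot p d → Quot p d
  norm zero    v = zeroQ p
  norm (suc n) v = addQ p (norm n v) (mulτ^ p n v)

  toℕ-coeff-norm : ∀ {d} (v : Quot p d) n {m} → m < d →
                   toℕ (coeff (norm n v) m) ≡ convolve (λ k → n C suc k) (coords v) m % p
  toℕ-coeff-norm {d} v zero {m} _ =
    trans (cong toℕ (coeff-zeroQ {d} m)) (trans (toℕ-mod 0) (cong (_% p) (sym (convolve-zeroˡ (coords v) m))))
  toℕ-coeff-norm v (suc n) {m} m<d =
    trans (cong toℕ (coeff-addQ (norm n v) (mulτ^ p n v) m<d))
          (trans (toℕ-+ₚ (toℕ-coeff-norm v n m<d) (toℕ-coeff-mulτ^ v n m<d))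
                 (cong (_% p) (sym (convolve-pascal (coords v) n m))))

  norm-zeroQ : ∀ {d} n → norm n (zeroQ p {d}) ≡ zeroQ p
  norm-zeroQ zero        = refl
  norm-zeroQ {d} (suc n) rewrite norm-zeroQ {d} n | mulτ^-zeroQ {d} n = addQ-identityˡ (zeroQ p)

  -- The term e·(τ-1)^(d-1) = σ̃^p that mulB adds when the exponents of σ̃ overflow p.
  carry : ∀ {d} → 𝔽 p → ℕ → Quot p d
  carry e n = if p ≤ᵇ n then top p e else zeroQ p

  carry-< : ∀ {d} e {n} → n < p → carry {d} e n ≡ zeroQ p
  carry-< e n<p = cong (if_then top p e else zeroQ p) (>⇒≤ᵇ-false n<p)

  carry-≥ : ∀ {d} e {n} → p ≤ n → carry {d} e n ≡ top p e
  carry-≥ e p≤n = cong (if_then top p e else zeroQ p) (≤⇒≤ᵇ-true p≤n)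

  -- powB d e g n = g^(n+1); starting at g spares proving that homomorphisms preserve 1.
  powB : ∀ d e → B p d e → ℕ → B p d e
  powB d e g zero    = g
  powB d e g (suc n) = mulB p d e (powB d e g n) g

  hom-powB : ∀ {i j e e'} (φ : B p i e → B p j e') → IsHom p i j e e' φ →
             ∀ g n → φ (powB i e g n) ≡ powB j e' (φ g) n
  hom-powB φ hom g zero    = refl
  hom-powB {j = j} {e' = e'} φ hom g (suc n) =
    trans (hom (powB _ _ g n) g) (cong (λ h → mulB p j e' h (φ g)) (hom-powB φ hom g n))

  -- The quotient maps B_{i,e} → B_{j,0}

  module Truncation {i j} (j≤i : j ≤ i) where

    truncateQ : Quot p i → Quot p j
    truncateQ a = tabulate (λ m → lookup a (inject≤ m j≤i))

    coeff-truncateQ : ∀ a {m} → m < j → coeff (truncateQ a) m ≡ coeff a m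
    coeff-truncateQ a {m} m<j =
      trans (cong (λ w → coeff w m) (tabulate-cong lookup≗coeff)) (coeff-tabulate (coeff a) m<j)
      where
        lookup≗coeff : ∀ t → lookup a (inject≤ t j≤i) ≡ coeff a (toℕ t)
        lookup≗coeff t = trans (coeff-lookup a (inject≤ t j≤i)) (cong (coeff a) (toℕ-inject≤ t j≤i))

    truncateQ-≡zeroQ⇔ : ∀ a → truncateQ a ≡ zeroQ p ⇔ VanishesBelow j a
    truncateQ-≡zeroQ⇔ a = mk⇔
      (λ a↦0 m m<j → trans (sym (coeff-truncateQ a m<j)) (trans (cong (λ w → coeff w m) a↦0) (coeff-zeroQ {j} m)))
      (λ a≈0 → vanishesBelow⇒≡zeroQ λ m m<j → trans (coeff-truncateQ a m<j) (a≈0 m m<j))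

    truncateQ-addQ : ∀ v w → truncateQ (addQ p v w) ≡ addQ p (truncateQ v) (truncateQ w)
    truncateQ-addQ v w = coeff-ext λ m m<j → begin
      coeff (truncateQ (addQ p v w)) m               ≡⟨ coeff-truncateQ (addQ p v w) m<j ⟩
      coeff (addQ p v w) m                           ≡⟨ coeff-addQ v w (<-≤-trans m<j j≤i) ⟩
      coeff v m +ₚ coeff w m
        ≡⟨ sym (cong₂ _+ₚ_ (coeff-truncateQ v m<j) (coeff-truncateQ w m<j)) ⟩
      coeff (truncateQ v) m +ₚ coeff (truncateQ w) m ≡⟨ sym (coeff-addQ (truncateQ v) (truncateQ w) m<j) ⟩
      coeff (addQ p (truncateQ v) (truncateQ w)) m   ∎
      where open ≡-Reasoning

    truncateQ-scaleQ : ∀ c v → truncateQ (scaleQ p c v) ≡ scaleQ p c (truncateQ v)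
    truncateQ-scaleQ c v = coeff-ext λ m m<j → begin
      coeff (truncateQ (scaleQ p c v)) m ≡⟨ coeff-truncateQ (scaleQ p c v) m<j ⟩
      coeff (scaleQ p c v) m             ≡⟨ coeff-scaleQ c v (<-≤-trans m<j j≤i) ⟩
      c *ₚ coeff v m                     ≡⟨ sym (cong (c *ₚ_) (coeff-truncateQ v m<j)) ⟩
      c *ₚ coeff (truncateQ v) m         ≡⟨ sym (coeff-scaleQ c (truncateQ v) m<j) ⟩
      coeff (scaleQ p c (truncateQ v)) m ∎
      where open ≡-Reasoning

    truncateQ-mulX : ∀ v → truncateQ (mulX p v) ≡ mulX p (truncateQ v)
    truncateQ-mulX v = coeff-ext coeff≡
      where
        coeff≡ : ∀ m → m < j → coeff (truncateQ (mulX p v)) m ≡ coeff (mulX p (truncateQ v)) m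
        coeff≡ zero    0<j   =
          trans (coeff-truncateQ (mulX p v) 0<j) (trans (coeff-mulX-zero v) (sym (coeff-mulX-zero (truncateQ v))))
        coeff≡ (suc m) 1+m<j = begin
          coeff (truncateQ (mulX p v)) (suc m) ≡⟨ coeff-truncateQ (mulX p v) 1+m<j ⟩
          coeff (mulX p v) (suc m)             ≡⟨ coeff-mulX-suc v (<-≤-trans 1+m<j j≤i) ⟩
          coeff v m                            ≡⟨ sym (coeff-truncateQ v (<-trans (n<1+n m) 1+m<j)) ⟩
          coeff (truncateQ v) m                ≡⟨ sym (coeff-mulX-suc (truncateQ v) 1+m<j) ⟩
          coeff (mulX p (truncateQ v)) (suc m) ∎
          where open ≡-Reasoning

    truncateQ-mulτ^ : ∀ n v → truncateQ (mulτ^ p n v) ≡ mulτ^ p n (truncateQ v)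
    truncateQ-mulτ^ zero    v = refl
    truncateQ-mulτ^ (suc n) v = trans (truncateQ-addQ w (mulX p w))
      (cong₂ (addQ p) (truncateQ-mulτ^ n v) (trans (truncateQ-mulX w) (cong (mulX p) (truncateQ-mulτ^ n v))))
      where w = mulτ^ p n v

  module QuotientMap {i j} (j<i : j < i) (e : 𝔽 p) where
    open Truncation (<⇒≤ j<i)

    truncateQ-zeroQ : truncateQ (zeroQ p) ≡ zeroQ p
    truncateQ-zeroQ = Equivalence.from (truncateQ-≡zeroQ⇔ (zeroQ p)) (λ m _ → coeff-zeroQ {i} m)

    truncateQ-carry : ∀ n → truncateQ (carry e n) ≡ carry 0ₚ n
    truncateQ-carry n with p ≤ᵇ n
    ... | true  = trans (Equivalence.from (truncateQ-≡zeroQ⇔ (top p e)) (top-vanishesBelow e j<i)) (sym top-0ₚ)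
    ... | false = truncateQ-zeroQ

    quotMap-hom : IsHom p i j e 0ₚ (quotMap p i j e (<⇒≤ j<i))
    quotMap-hom (a , k) (b , l) = cong (_, k +ₚ l) (begin
      truncateQ (addQ p (addQ p a (mulτ^ p (toℕ k) b)) (carry e n))
        ≡⟨ truncateQ-addQ (addQ p a (mulτ^ p (toℕ k) b)) (carry e n) ⟩
      addQ p (truncateQ (addQ p a (mulτ^ p (toℕ k) b))) (truncateQ (carry e n))
        ≡⟨ cong₂ (addQ p) (truncateQ-addQ a (mulτ^ p (toℕ k) b)) (truncateQ-carry n) ⟩
      addQ p (addQ p (truncateQ a) (truncateQ (mulτ^ p (toℕ k) b))) (carry 0ₚ n)
        ≡⟨ cong (λ w → addQ p (addQ p (truncateQ a) w) (carry 0ₚ n)) (truncateQ-mulτ^ (toℕ k) b) ⟩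
      addQ p (addQ p (truncateQ a) (mulτ^ p (toℕ k) (truncateQ b))) (carry 0ₚ n) ∎)
      where
        open ≡-Reasoning
        n = toℕ k + toℕ l

    extendQ : Quot p j → Quot p i
    extendQ b = tabulate (coeff b ∘ toℕ)

    truncateQ-extendQ : ∀ b → truncateQ (extendQ b) ≡ b
    truncateQ-extendQ b = coeff-ext λ m m<j →
      trans (coeff-truncateQ (extendQ b) m<j) (coeff-tabulate (coeff b) (<-trans m<j j<i))

    quotMap-isGSurjection : IsGSurjection p i j e 0ₚ (quotMap p i j e (<⇒≤ j<i))
    quotMap-isGSurjection = record
      { hom        = quotMap-hom
      ; surjective = λ (b , k) → (extendQ b , k) , cong (_, k) (truncateQ-extendQ b)
      ; kerInA     = λ _ → ,-injectiveʳ
      ; overG      = λ _ → refl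
      ; restrictA  = λ _ → refl
      ; restrAdd   = truncateQ-addQ
      ; restrScale = truncateQ-scaleQ
      ; restrτ     = truncateQ-mulτ^ 1
      }

    quotMap-kernel : KernelIsAjAi p i j e 0ₚ (quotMap p i j e (<⇒≤ j<i))
    quotMap-kernel (a , k) = mk⇔
      (λ a,k↦1 → Equivalence.from (InAjAi⇔ {j = j} {e = e} a k)
                   (,-injectiveʳ a,k↦1 , Equivalence.to (truncateQ-≡zeroQ⇔ a) (,-injectiveˡ a,k↦1)))
      (λ a,k∈Aj → let (k≡0 , a≈0) = Equivalence.to (InAjAi⇔ {j = j} {e = e} a k) a,k∈Aj
                  in cong₂ _,_ (Equivalence.from (truncateQ-≡zeroQ⇔ a) a≈0) k≡0)

  module _ (p-prime : Prime p) where

    1<p : 1 < p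
    1<p = nonTrivial⇒n>1 p {{prime⇒nonTrivial p-prime}}

    1ₚ : 𝔽 p
    1ₚ = 1 mod p

    1ₚ≢0ₚ : 1ₚ ≢ 0ₚ
    1ₚ≢0ₚ 1≡0 with trans (sym (toℕ-mod-< 1<p)) (trans (cong toℕ 1≡0) toℕ-0ₚ)
    ... | ()

    *ₚ-identityʳ : (a : 𝔽 p) → a *ₚ 1ₚ ≡ a
    *ₚ-identityʳ a = toℕ-injective (begin
      toℕ (a *ₚ 1ₚ)        ≡⟨ toℕ-mod _ ⟩
      (toℕ a * toℕ 1ₚ) % p ≡⟨ cong (λ z → (toℕ a * z) % p) (toℕ-mod-< 1<p) ⟩
      (toℕ a * 1) % p      ≡⟨ cong (_% p) (*-identityʳ (toℕ a)) ⟩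
      toℕ a % p            ≡⟨ toℕ%p a ⟩
      toℕ a                ∎)
      where open ≡-Reasoning

    *ₚ-zero-divisor : ∀ (a b : 𝔽 p) → a *ₚ b ≡ 0ₚ → a ≡ 0ₚ ⊎ b ≡ 0ₚ
    *ₚ-zero-divisor a b ab≡0
      with euclidsLemma (toℕ a) (toℕ b) p-prime
             (m%n≡0⇒n∣m _ p (trans (sym (toℕ-mod _)) (trans (cong toℕ ab≡0) toℕ-0ₚ)))
    ... | inj₁ p∣a = inj₁ (∣⇒≡0ₚ (sym (toℕ%p a)) p∣a)
    ... | inj₂ p∣b = inj₂ (∣⇒≡0ₚ (sym (toℕ%p b)) p∣b)

    norm-vanishes : ∀ {d} (v : Quot p d) → d < p → norm p v ≡ zeroQ p
    norm-vanishes {d} v d<p = coeff-ext λ m m<d →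
      trans (∣⇒≡0ₚ (toℕ-coeff-norm v p m<d) (convolve-∣ˡ (coords v) m λ k k≤m →
                  prime∣pCk p-prime z<s (≤-<-trans (≤-trans (s≤s k≤m) m<d) d<p)))
            (sym (coeff-zeroQ {d} m))

    mulB-σ̃ : ∀ d e (a c : Quot p d) {n} → n < p →
             mulB p d e (a , n mod p) (c , 1ₚ) ≡ (addQ p (addQ p a (mulτ^ p n c)) (carry e (suc n)) , suc n mod p)
    mulB-σ̃ d e a c {n} n<p rewrite toℕ-mod-< n<p | toℕ-mod-< 1<p | +-comm n 1 = refl

    powB-σ̃ : ∀ d e (c : Quot p d) n → suc n < p → powB d e (c , 1ₚ) n ≡ (norm (suc n) c , suc n mod p)
    powB-σ̃ d e c zero    _     = cong (_, 1ₚ) (sym (addQ-identityˡ c))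
    powB-σ̃ d e c (suc n) 2+n<p = begin
      mulB p d e (powB d e (c , 1ₚ) n) (c , 1ₚ)
        ≡⟨ cong (λ g → mulB p d e g (c , 1ₚ)) (powB-σ̃ d e c n 1+n<p) ⟩
      mulB p d e (norm (suc n) c , suc n mod p) (c , 1ₚ) ≡⟨ mulB-σ̃ d e (norm (suc n) c) c 1+n<p ⟩
      (addQ p (norm (suc (suc n)) c) (carry e (suc (suc n))) , suc (suc n) mod p)
        ≡⟨ cong (_, suc (suc n) mod p) (trans (cong (addQ p _) (carry-< e 2+n<p)) (addQ-identityʳ _)) ⟩
      (norm (suc (suc n)) c , suc (suc n) mod p)        ∎
      where
        open ≡-Reasoning
        1+n<p = <-trans (n<1+n (suc n)) 2+n<p

    powB-σ̃-last : ∀ d e (c : Quot p d) n → suc (suc n) ≡ p →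
                  powB d e (c , 1ₚ) (suc n) ≡ (addQ p (norm p c) (top p e) , 0ₚ)
    powB-σ̃-last d e c n 2+n≡p = begin
      mulB p d e (powB d e (c , 1ₚ) n) (c , 1ₚ)
        ≡⟨ cong (λ g → mulB p d e g (c , 1ₚ)) (powB-σ̃ d e c n 1+n<p) ⟩
      mulB p d e (norm (suc n) c , suc n mod p) (c , 1ₚ) ≡⟨ mulB-σ̃ d e (norm (suc n) c) c 1+n<p ⟩
      (addQ p (norm (suc (suc n)) c) (carry e (suc (suc n))) , suc (suc n) mod p)
        ≡⟨ cong₂ _,_ (cong₂ (addQ p) (cong (λ m → norm m c) 2+n≡p) (carry-≥ e (≤-reflexive (sym 2+n≡p))))
                     (trans (cong (_mod p) 2+n≡p) p-mod-p≡0ₚ) ⟩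
      (addQ p (norm p c) (top p e) , 0ₚ)                 ∎
      where
        open ≡-Reasoning
        1+n<p = ≤-reflexive 2+n≡p
        p-mod-p≡0ₚ : p mod p ≡ 0ₚ
        p-mod-p≡0ₚ = toℕ-injective (trans (toℕ-mod p) (trans (n%n≡0 p) (sym toℕ-0ₚ)))

    oneQ : ∀ {n} → Quot p (suc n)
    oneQ = 1ₚ ∷ zeroQ p

    constant+mulX : ∀ {n} (a : Quot p (suc n)) → a ≡ addQ p (scaleQ p (coeff a 0) oneQ) (mulX p (divX^ 1 a))
    constant+mulX {n} a = coeff-ext λ m m<n → sym (coeff≡ m m<n)
      where
        a₀ : 𝔽 p
        a₀ = coeff a 0
        a₀1+Xb = addQ p (scaleQ p a₀ (oneQ {n})) (mulX p (divX^ 1 a))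
        coeff≡ : ∀ m → m < suc n → coeff a₀1+Xb m ≡ coeff a m
        coeff≡ zero 0<n = begin
          coeff a₀1+Xb 0
            ≡⟨ coeff-addQ (scaleQ p a₀ oneQ) (mulX p (divX^ 1 a)) 0<n ⟩
          coeff (scaleQ p a₀ (oneQ {n})) 0 +ₚ coeff (mulX p (divX^ 1 a)) 0
            ≡⟨ cong₂ _+ₚ_ (coeff-scaleQ a₀ (oneQ {n}) 0<n) (coeff-mulX-zero (divX^ 1 a)) ⟩
          a₀ *ₚ 1ₚ +ₚ 0ₚ                                                ≡⟨ +ₚ-identityʳ _ ⟩
          a₀ *ₚ 1ₚ                                                      ≡⟨ *ₚ-identityʳ a₀ ⟩
          a₀                                                            ∎
          where open ≡-Reasoning
        coeff≡ (suc m) 1+m<n = begin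
          coeff a₀1+Xb (suc m)
            ≡⟨ coeff-addQ (scaleQ p a₀ oneQ) (mulX p (divX^ 1 a)) 1+m<n ⟩
          coeff (scaleQ p a₀ (oneQ {n})) (suc m) +ₚ coeff (mulX p (divX^ 1 a)) (suc m)
            ≡⟨ cong₂ _+ₚ_ (coeff-scaleQ a₀ (oneQ {n}) 1+m<n) (coeff-mulX-suc (divX^ 1 a) 1+m<n) ⟩
          a₀ *ₚ coeff (zeroQ p {n}) m +ₚ coeff (divX^ 1 a) m
            ≡⟨ cong₂ _+ₚ_ (trans (cong (a₀ *ₚ_) (coeff-zeroQ {n} m)) (*ₚ-zeroʳ a₀))
                          (coeff-divX^ 1 a (<-trans (n<1+n m) 1+m<n)) ⟩
          0ₚ +ₚ coeff a (m + 1)                                         ≡⟨ +ₚ-identityˡ _ ⟩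
          coeff a (m + 1)                                               ≡⟨ cong (coeff a) (+-comm m 1) ⟩
          coeff a (suc m)                                               ∎
          where open ≡-Reasoning

    -- G-surjections

    module GSurjection {i j e e'} (φ : B p (suc i) e → B p (suc j) e')
                       (φ-isGSurjection : IsGSurjection p (suc i) (suc j) e e' φ) where
      open IsGSurjection φ-isGSurjection

      φᴬ : Quot p (suc i) → Quot p (suc j)
      φᴬ a = proj₁ (φ (a , 0ₚ))

      φ-on-A : ∀ a → φ (a , 0ₚ) ≡ (φᴬ a , 0ₚ)
      φ-on-A a = cong (φᴬ a ,_) (restrictA a)

      φᴬ-mulX : ∀ a → φᴬ (mulX p a) ≡ mulX p (φᴬ a)
      φᴬ-mulX a = addQ-cancelˡ (φᴬ a) _ _ (trans (sym (restrAdd a (mulX p a))) (restrτ a))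

      φᴬ-mulX^ : ∀ k a → φᴬ (mulX^ k a) ≡ mulX^ k (φᴬ a)
      φᴬ-mulX^ zero    a = refl
      φᴬ-mulX^ (suc k) a = trans (φᴬ-mulX (mulX^ k a)) (cong (mulX p) (φᴬ-mulX^ k a))

      u₀ : 𝔽 p
      u₀ = coeff (φᴬ oneQ) 0

      coeff₀-φᴬ : ∀ a → coeff (φᴬ a) 0 ≡ coeff a 0 *ₚ u₀
      coeff₀-φᴬ a = begin
        coeff (φᴬ a) 0
          ≡⟨ cong (λ v → coeff (φᴬ v) 0) (constant+mulX a) ⟩
        coeff (φᴬ (addQ p (scaleQ p a₀ oneQ) (mulX p b))) 0
          ≡⟨ cong (λ v → coeff v 0) (restrAdd (scaleQ p a₀ oneQ) (mulX p b)) ⟩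
        coeff (addQ p (φᴬ (scaleQ p a₀ oneQ)) (φᴬ (mulX p b))) 0
          ≡⟨ coeff-addQ (φᴬ (scaleQ p a₀ oneQ)) (φᴬ (mulX p b)) z<s ⟩
        coeff (φᴬ (scaleQ p a₀ oneQ)) 0 +ₚ coeff (φᴬ (mulX p b)) 0
          ≡⟨ cong₂ (λ v w → coeff v 0 +ₚ coeff w 0) (restrScale a₀ oneQ) (φᴬ-mulX b) ⟩
        coeff (scaleQ p a₀ (φᴬ oneQ)) 0 +ₚ coeff (mulX p (φᴬ b)) 0
          ≡⟨ cong₂ _+ₚ_ (coeff-scaleQ a₀ (φᴬ oneQ) z<s) (coeff-mulX-zero (φᴬ b)) ⟩
        a₀ *ₚ u₀ +ₚ 0ₚ
          ≡⟨ +ₚ-identityʳ _ ⟩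
        a₀ *ₚ u₀                                             ∎
        where
          open ≡-Reasoning
          a₀ = coeff a 0
          b  = divX^ 1 a

      u₀≢0ₚ : u₀ ≢ 0ₚ
      u₀≢0ₚ u₀≡0 with surjective (oneQ , 0ₚ)
      ... | (a , k) , φa,k≡1 = 1ₚ≢0ₚ (begin
        1ₚ              ≡⟨ cong (λ v → coeff v 0) (sym φᴬa≡1) ⟩
        coeff (φᴬ a) 0  ≡⟨ coeff₀-φᴬ a ⟩
        coeff a 0 *ₚ u₀ ≡⟨ cong (coeff a 0 *ₚ_) u₀≡0 ⟩
        coeff a 0 *ₚ 0ₚ ≡⟨ *ₚ-zeroʳ (coeff a 0) ⟩
        0ₚ              ∎)
        where
          open ≡-Reasoning
          k≡0 : k ≡ 0ₚ
          k≡0 = trans (sym (overG (a , k))) (,-injectiveʳ φa,k≡1)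
          φᴬa≡1 : φᴬ a ≡ oneQ
          φᴬa≡1 = ,-injectiveˡ (subst (λ k → φ (a , k) ≡ (oneQ , 0ₚ)) k≡0 φa,k≡1)

      *u₀-cancel : ∀ {x} → x *ₚ u₀ ≡ 0ₚ → x ≡ 0ₚ
      *u₀-cancel {x} xu₀≡0 with *ₚ-zero-divisor x u₀ xu₀≡0
      ... | inj₁ x≡0  = x≡0
      ... | inj₂ u₀≡0 = ⊥-elim (u₀≢0ₚ u₀≡0)

      coeff-φᴬ-leading : ∀ a m → VanishesBelow m a → m < suc j → coeff (φᴬ a) m ≡ coeff a m *ₚ u₀
      coeff-φᴬ-leading a m a≈0 m<j = begin
        coeff (φᴬ a) m           ≡⟨ cong (λ v → coeff (φᴬ v) m) (sym (mulX^-divX^ m a a≈0)) ⟩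
        coeff (φᴬ (mulX^ m b)) m ≡⟨ cong (λ v → coeff v m) (φᴬ-mulX^ m b) ⟩
        coeff (mulX^ m (φᴬ b)) m ≡⟨ coeff-mulX^-≥ m (φᴬ b) ≤-refl m<j ⟩
        coeff (φᴬ b) (m ∸ m)     ≡⟨ cong (coeff (φᴬ b)) (n∸n≡0 m) ⟩
        coeff (φᴬ b) 0           ≡⟨ coeff₀-φᴬ b ⟩
        coeff b 0 *ₚ u₀          ≡⟨ cong (_*ₚ u₀) (coeff-divX^ m a z<s) ⟩
        coeff a m *ₚ u₀          ∎
        where
          open ≡-Reasoning
          b = divX^ m a

      φᴬ-vanishing : ∀ a → VanishesBelow (suc j) a → φᴬ a ≡ zeroQ p
      φᴬ-vanishing a a≈0 = begin
        φᴬ a                                 ≡⟨ cong φᴬ (sym (mulX^-divX^ (suc j) a a≈0)) ⟩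
        φᴬ (mulX^ (suc j) (divX^ (suc j) a)) ≡⟨ φᴬ-mulX^ (suc j) (divX^ (suc j) a) ⟩
        mulX^ (suc j) (φᴬ (divX^ (suc j) a)) ≡⟨ mulX^-nilpotent (suc j) _ ≤-refl ⟩
        zeroQ p                              ∎
        where open ≡-Reasoning

      ker-φᴬ : ∀ a → φᴬ a ≡ zeroQ p → VanishesBelow (suc j) a
      ker-φᴬ a φᴬa≡0 = <-rec (λ m → m < suc j → coeff a m ≡ 0ₚ) step
        where
          step : ∀ m → (∀ {l} → l < m → l < suc j → coeff a l ≡ 0ₚ) → m < suc j → coeff a m ≡ 0ₚ
          step m below m<j = *u₀-cancel (begin
            coeff a m *ₚ u₀           ≡⟨ sym (coeff-φᴬ-leading a m vanishes m<j) ⟩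
            coeff (φᴬ a) m            ≡⟨ cong (λ v → coeff v m) φᴬa≡0 ⟩
            coeff (zeroQ p {suc j}) m ≡⟨ coeff-zeroQ {suc j} m ⟩
            0ₚ                        ∎)
            where
              open ≡-Reasoning
              vanishes : VanishesBelow m a
              vanishes l l<m = below l<m (<-trans l<m m<j)

      ker-φ : ∀ a k → φ (a , k) ≡ oneB p (suc j) e' ⇔ (k ≡ 0ₚ × VanishesBelow (suc j) a)
      ker-φ a k = mk⇔ to from
        where
          to : φ (a , k) ≡ oneB p (suc j) e' → k ≡ 0ₚ × VanishesBelow (suc j) a
          to φa,k≡1 = k≡0 , ker-φᴬ a (,-injectiveˡ (trans (sym (φ-on-A a)) φa,0≡1))
            where
              k≡0    = kerInA (a , k) φa,k≡1
              φa,0≡1 = subst (λ k → φ (a , k) ≡ oneB p (suc j) e') k≡0 φa,k≡1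
          from : k ≡ 0ₚ × VanishesBelow (suc j) a → φ (a , k) ≡ oneB p (suc j) e'
          from (k≡0 , a≈0) =
            subst (λ k → φ (a , k) ≡ _) (sym k≡0) (trans (φ-on-A a) (cong (_, 0ₚ) (φᴬ-vanishing a a≈0)))

      kernel-is-AjAi : KernelIsAjAi p (suc i) (suc j) e e' φ
      kernel-is-AjAi (a , k) = ⇔-trans (ker-φ a k) (⇔-sym (InAjAi⇔ {j = suc j} {e = e} a k))

      nontrivialKernel⇒j<i : NontrivialKernel p (suc i) (suc j) e e' φ → suc j < suc i
      nontrivialKernel⇒j<i ((a , k) , φg≡1 , g≢1) = ≰⇒> λ i≤j →
        let (k≡0 , a≈0) = Equivalence.to (ker-φ a k) φg≡1
        in g≢1 (cong₂ _,_ (vanishesBelow⇒≡zeroQ (vanishesBelow-mono a i≤j a≈0)) k≡0)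

      j<i⇒e'≡0ₚ : suc j < suc i → suc i ≤ p → e' ≡ 0ₚ
      j<i⇒e'≡0ₚ j<i i≤p = begin
        e'                         ≡⟨ sym (coeff-top-last {j} e') ⟩
        coeff (top p {suc j} e') j ≡⟨ cong (λ v → coeff v j) (,-injectiveˡ φσ̃ᵖ≡1) ⟩
        coeff (zeroQ p {suc j}) j  ≡⟨ coeff-zeroQ {suc j} j ⟩
        0ₚ                         ∎
        where
          open ≡-Reasoning
          n = p ∸ 2
          2+n≡p : suc (suc n) ≡ p
          2+n≡p = trans (+-comm 2 n) (m∸n+n≡m 1<p)
          σ̃ : B p (suc i) e
          σ̃ = (zeroQ p , 1ₚ)
          c = proj₁ (φ σ̃)
          φσ̃ᵖ≡1 : (top p e' , 0ₚ) ≡ oneB p (suc j) e'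
          φσ̃ᵖ≡1 = begin
            (top p e' , 0ₚ)                     ≡⟨ cong (_, 0ₚ) (sym (addQ-identityˡ (top p e'))) ⟩
            (addQ p (zeroQ p) (top p e') , 0ₚ)  ≡⟨ cong (λ v → addQ p v (top p e') , 0ₚ) (sym norm≡0) ⟩
            (addQ p (norm p c) (top p e') , 0ₚ) ≡⟨ sym (powB-σ̃-last (suc j) e' c n 2+n≡p) ⟩
            powB (suc j) e' (c , 1ₚ) (suc n)
              ≡⟨ cong (λ g → powB (suc j) e' (c , g) (suc n)) (sym (overG σ̃)) ⟩
            powB (suc j) e' (φ σ̃) (suc n)      ≡⟨ sym (hom-powB φ hom σ̃ (suc n)) ⟩
            φ (powB (suc i) e σ̃ (suc n))       ≡⟨ cong φ (powB-σ̃-last (suc i) e (zeroQ p) n 2+n≡p) ⟩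
            φ (addQ p (norm p (zeroQ p)) (top p e) , 0ₚ)
              ≡⟨ cong (λ v → φ (addQ p v (top p e) , 0ₚ)) (norm-zeroQ p) ⟩
            φ (addQ p (zeroQ p) (top p e) , 0ₚ) ≡⟨ cong (λ v → φ (v , 0ₚ)) (addQ-identityˡ (top p e)) ⟩
            φ (top p e , 0ₚ)
              ≡⟨ Equivalence.from (ker-φ (top p e) 0ₚ) (refl , top-vanishesBelow e j<i) ⟩
            oneB p (suc j) e'                   ∎
            where norm≡0 = norm-vanishes c (<-≤-trans j<i i≤p)

lemma2 : (p : ℕ) .{{_ : NonZero p}} → Prime p → ¬ (2 ∣ p) →
    ((i j : ℕ) → 1 ≤ i → i ≤ p → 1 ≤ j → j ≤ p → (e e' : 𝔽 p) →
      (φ : B p i e → B p j e') → IsGSurjection p i j e e' φ → NontrivialKernel p i j e e' φ →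
      (j < i) × (e' ≡ 0F p) × KernelIsAjAi p i j e e' φ)
    × ((i j : ℕ) → (j<i : j < i) → i ≤ p → 1 ≤ j → (e : 𝔽 p) →
      IsGSurjection p i j e (0F p) (quotMap p i j e (<⇒≤ j<i))
      × KernelIsAjAi p i j e (0F p) (quotMap p i j e (<⇒≤ j<i)))
lemma2 p p-prime _ =
  (λ { (suc i) (suc j) (s≤s z≤n) i≤p (s≤s z≤n) _ e e' φ φ-isGSurjection nontrivial →
         let open GSurjection p p-prime φ φ-isGSurjection
             j<i = nontrivialKernel⇒j<i nontrivial
         in j<i , j<i⇒e'≡0ₚ j<i i≤p , kernel-is-AjAi })
  , λ i j j<i _ _ e →
      let open QuotientMap p j<i e
      in quotMap-isGSurjection , quotMap-kernel
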